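{- If $n\geq 2$, then $B(P_3 \square P_n) = 3$ if $n = 2$, and $B(P_3 \square P_n) = 4$ if $n\geq 3$.
   Context: $P_n$ is the path on $n$ vertices. The Cartesian product $G\square H$ has vertex set $V(G)\times V(H)$, with $(u,v)$ adjacent to $(x,y)$ iff either $ux\in E(G)$ and $v=y$, or $u=x$ and $vy\in E(H)$. Bodyguards and Presidents is a two-player game on a finite simple graph $G$. One player controls a set of tokens called bodyguards, the other a single token called the president. First all bodyguards are placed on vertices (several may share a vertex), then the president is placed. The players then alternate turns, bodyguards first; on a player's turn, each token they control either moves to an adjacent vertex or stays put. The president is surrounded if every vertex of the open neighbourhood of the president's vertex is occupied by a bodyguard. The bodyguards win if there is a finite time after which, at the end of every bodyguard turn, the president is surrounded; otherwise the president wins. The bodyguard number $B(G)$ is the minimum number of bodyguards that guarantees a win for the bodyguards on $G$. -}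

module Defs where

open import Data.Nat using (ℕ; zero; suc; _≤_; _<_)
open import Data.Fin using (Fin; toℕ)
open import Data.Product using (_×_; _,_; ∃; ∃-syntax)
open import Data.Sum using (_⊎_)
open import Relation.Nullary using (¬_)
open import Relation.Binary.PropositionalEquality using (_≡_)

PathAdj : (n : ℕ) → Fin n → Fin n → Set
PathAdj n i j = toℕ j ≡ suc (toℕ i) ⊎ toℕ i ≡ suc (toℕ j)

record GraphOn : Set₁ where
  field
    V   : Set
    E   : V → V → Set

open GraphOn public

PathGrid : ℕ → ℕ → GraphOn
PathGrid m n = record
  { V = Fin m × Fin n
  ; E = λ { (u , v) (x , y) →
            (PathAdj m u x × v ≡ y) ⊎ (u ≡ x × PathAdj n v y) } }

module Game (G : GraphOn) where
  open GraphOn G renaming (V to Vtx; E to Adj')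

  -- Positions of k bodyguards (several may share a vertex).
  Conf : ℕ → Set
  Conf k = Fin k → Vtx

  LegalMove : ∀ {k} → Conf k → Conf k → Set
  LegalMove c c' = ∀ i → c' i ≡ c i ⊎ Adj' (c i) (c' i)

  LegalPres : (ℕ → Vtx) → Set
  LegalPres p = ∀ t → p (suc t) ≡ p t ⊎ Adj' (p t) (p (suc t))

  Surrounded : ∀ {k} → Conf k → Vtx → Set
  Surrounded c v = ∀ w → Adj' v w → ∃[ i ] c i ≡ w

  -- A bodyguard strategy: an initial placement, and the configuration after
  -- bodyguard turn t+1 as a function of the president's positions p 0 … p t.
  -- (Bodyguards' own earlier moves are determined by these, so this is fully general.)
  record BStrategy (k : ℕ) : Set where
    field
      place : Conf k
      move  : (t : ℕ) → (Fin (suc t) → Vtx) → Conf k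

  conf : ∀ {k} → BStrategy k → (ℕ → Vtx) → ℕ → Conf k
  conf σ p zero    = BStrategy.place σ
  conf σ p (suc t) = BStrategy.move σ t (λ i → p (toℕ i))

  -- σ is winning: against every legal president play, all bodyguard moves are
  -- legal, and from some time on, at the end of every bodyguard turn
  -- (bodyguards at conf (suc t), president still at p t) the president is surrounded.
  Winning : ∀ {k} → BStrategy k → Set
  Winning σ = ∀ (p : ℕ → Vtx) → LegalPres p →
    (∀ t → LegalMove (conf σ p t) (conf σ p (suc t))) ×
    ∃[ T ] (∀ t → T ≤ t → Surrounded (conf σ p (suc t)) (p t))

  BodyguardsWin : ℕ → Set
  BodyguardsWin k = ∃[ σ ] Winning {k} σ

BodyguardNumberIs : GraphOn → ℕ → Set
BodyguardNumberIs G k = BodyguardsWin k × (∀ m → m < k → ¬ BodyguardsWin m)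
  where open Game G

module Submission where

-- Lower bounds: against a president that never leaves a vertex v, the guards that
-- eventually stand on the neighbours of v are pairwise distinct, so at least deg v
-- guards are needed. P₃ □ P₂ has a vertex of degree 3, P₃ □ Pₙ (n ≥ 3) one of degree 4.
--
-- Three guards on P₃ □ P₂ follow a fixed formation for each president vertex; the
-- formation surrounds that vertex, and formations of adjacent vertices differ by at
-- most one step of each guard. On six vertices this is checked by evaluation.
--
-- Four guards on P₃ □ Pₙ start as a wall in column 0, one guard per row and the fourth
-- in the middle row, and push the wall right while the president is at least two
-- columns ahead. Once the president is next to or on the wall, they chase it: one guard
-- on every vertex of its column and one directly behind it, so that its only escape is
-- to the right. As soon as it does anything else, they switch to a formation that
-- surrounds it and that can be kept up against every move. Both the wall and the chase
-- gain a column every turn, so the president is surrounded after n turns at the latest.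

open import Defs
open import Data.Bool using (Bool; true; false)
open import Data.Fin using (Fin; zero; suc; toℕ; inject₁)
open import Data.Fin.Patterns using (0F; 1F; 2F; 3F)
open import Data.Fin.Permutation using (Permutation′; _⟨$⟩ʳ_; _⟨$⟩ˡ_; inverseʳ; transpose)
  renaming (id to idₚ)
open import Data.Fin.Properties using (<⇒notInjective; all?; any?; toℕ≤pred[n])
  renaming (_≟_ to _≟ᶠ_)
open import Data.Nat using (ℕ; zero; suc; pred; _+_; _≤_; _<_; z≤n; s≤s; _≤?_; _≟_)
open import Data.Nat.Properties
  using ( ≤-refl; ≤-trans; ≤-antisym; ≤-pred; n≤1+n; n<1+n; m<n⇒m<1+n; 1+n≢n; <⇒≤; <-irrefl
        ; <-trans; ≤-<-trans; ≰⇒>; ≤∧≢⇒<)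
open import Data.Product using (_×_; _,_; proj₁; proj₂; ∃-syntax)
open import Data.Product.Properties using (≡-dec)
open import Data.Sum using (_⊎_; inj₁; inj₂)
open import Data.Unit using (⊤; tt)
open import Data.Vec.Functional using ([]; _∷_)
open import Function using (_∘_)
open import Function.Definitions using (Injective)
open import Relation.Binary.Definitions using (DecidableEquality)
open import Relation.Binary.PropositionalEquality
  using (_≡_; _≢_; refl; sym; trans; cong; cong₂; subst; subst₂; module ≡-Reasoning)
open import Relation.Nullary using (¬_; Dec; yes; no; does; contradiction)
open import Relation.Nullary.Decidable
  using (from-yes; map′; _×-dec_; _⊎-dec_; _→-dec_; dec-true; dec-false)

clamp : ∀ m → ℕ → Fin (suc m)
clamp zero    _       = zero
clamp (suc m) zero    = zero
clamp (suc m) (suc k) = suc (clamp m k)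

toℕ-clamp : ∀ {m k} → k ≤ m → toℕ (clamp m k) ≡ k
toℕ-clamp {zero}  z≤n     = refl
toℕ-clamp {suc m} z≤n     = refl
toℕ-clamp {suc m} (s≤s k≤m) = cong suc (toℕ-clamp k≤m)

clamp-toℕ : ∀ {m} (i : Fin (suc m)) → clamp m (toℕ i) ≡ i
clamp-toℕ {zero}  zero    = refl
clamp-toℕ {suc m} zero    = refl
clamp-toℕ {suc m} (suc i) = cong suc (clamp-toℕ i)

clamp-suc : ∀ m k → clamp m (suc k) ≡ clamp m k ⊎ toℕ (clamp m (suc k)) ≡ suc (toℕ (clamp m k))
clamp-suc zero    k    = inj₁ refl
clamp-suc (suc m) zero = inj₂ (cong suc (toℕ-clamp {m} z≤n))
clamp-suc (suc m) (suc k) with clamp-suc m k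
... | inj₁ same = inj₁ (cong suc same)
... | inj₂ next = inj₂ (cong suc next)

PathAdj-irrefl : ∀ {n} {i : Fin n} → ¬ PathAdj n i i
PathAdj-irrefl (inj₁ i≡1+i) = 1+n≢n (sym i≡1+i)
PathAdj-irrefl (inj₂ i≡1+i) = 1+n≢n (sym i≡1+i)

PathAdj? : ∀ n (i j : Fin n) → Dec (PathAdj n i j)
PathAdj? n i j = (toℕ j ≟ suc (toℕ i)) ⊎-dec (toℕ i ≟ suc (toℕ j))

module _ {m n : ℕ} where
  open Game (PathGrid m n)

  _≟ᵥ_ : DecidableEquality (Fin m × Fin n)
  _≟ᵥ_ = ≡-dec _≟ᶠ_ _≟ᶠ_

  adjacent? : ∀ (u v : Fin m × Fin n) → Dec (E (PathGrid m n) u v)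
  adjacent? (r , c) (r′ , c′) =
    (PathAdj? m r r′ ×-dec (c ≟ᶠ c′)) ⊎-dec ((r ≟ᶠ r′) ×-dec PathAdj? n c c′)

  all-vertices? : {P : Fin m × Fin n → Set} → (∀ v → Dec (P v)) → Dec (∀ v → P v)
  all-vertices? P? =
    map′ (λ all v → all (proj₁ v) (proj₂ v)) (λ all r c → all (r , c))
         (all? λ r → all? λ c → P? (r , c))

  injective? : ∀ {k} (w : Fin k → Fin m × Fin n) → Dec (Injective _≡_ _≡_ w)
  injective? w = map′ (λ inj {i} {j} → inj i j) (λ inj i j → inj)
                      (all? λ i → all? λ j → (w i ≟ᵥ w j) →-dec (i ≟ᶠ j))

  legal? : ∀ {k} (c c′ : Conf k) → Dec (LegalMove c c′)
  legal? c c′ = all? λ i → (c′ i ≟ᵥ c i) ⊎-dec adjacent? (c i) (c′ i)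

  surrounded? : ∀ {k} (c : Conf k) v → Dec (Surrounded c v)
  surrounded? c v = all-vertices? λ w → adjacent? v w →-dec any? λ i → c i ≟ᵥ w

module GameProperties (G : GraphOn) where
  open Game G

  Step : V G → V G → Set
  Step u v = v ≡ u ⊎ E G u v

  fewer-guards-than-neighbours-lose : ∀ {k} (v : V G) (w : Fin k → V G) →
    (∀ j → E G v (w j)) → Injective _≡_ _≡_ w → ∀ m → m < k → ¬ BodyguardsWin m
  fewer-guards-than-neighbours-lose {k} v w adj w-inj m m<k (σ , win) =
    <⇒notInjective m<k guard-injective
    where
    still : ℕ → V G
    still _ = v
    T : ℕ
    T = proj₁ (proj₂ (win still (λ _ → inj₁ refl)))
    surrounded : Surrounded (conf σ still (suc T)) v
    surrounded = proj₂ (proj₂ (win still (λ _ → inj₁ refl))) T ≤-refl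
    guard : Fin k → Fin m
    guard j = proj₁ (surrounded (w j) (adj j))
    guard-injective : Injective _≡_ _≡_ guard
    guard-injective {i} {j} same-guard = w-inj (begin
      w i                            ≡⟨ proj₂ (surrounded (w i) (adj i)) ⟨
      conf σ still (suc T) (guard i) ≡⟨ cong (conf σ still (suc T)) same-guard ⟩
      conf σ still (suc T) (guard j) ≡⟨ proj₂ (surrounded (w j) (adj j)) ⟩
      w j                            ∎)
      where open ≡-Reasoning

  module Controlled {k : ℕ} {State : Set}
    (placement : Conf k)
    (start     : V G → State)
    (update    : State → V G → V G → State)
    (formation : State → V G → Conf k) where

    run : (ℕ → V G) → ℕ → State
    run p zero    = start (p 0)
    run p (suc t) = update (run p t) (p t) (p (suc t))

    run-local : ∀ {p q} t → (∀ s → s ≤ t → p s ≡ q s) → run p t ≡ run q t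
    run-local zero    p≡q = cong start (p≡q 0 z≤n)
    run-local (suc t) p≡q =
      cong₂ (λ state (u , v) → update state u v)
            (run-local t (λ s s≤t → p≡q s (≤-trans s≤t (n≤1+n t))))
            (cong₂ _,_ (p≡q t (n≤1+n t)) (p≡q (suc t) ≤-refl))

    -- A history p 0 … p t is read as the play that stays at p t afterwards.
    strategy : BStrategy k
    strategy = record
      { place = placement
      ; move  = λ t history → let p = λ s → history (clamp t s) in formation (run p t) (p t)
      }

    conf-strategy : ∀ p t → conf strategy p (suc t) ≡ formation (run p t) (p t)
    conf-strategy p t = cong₂ formation (run-local t agree) (agree t ≤-refl)
      where
      agree : ∀ s → s ≤ t → p (toℕ (clamp t s)) ≡ p s
      agree s s≤t = cong p (toℕ-clamp s≤t)

    record Certificate : Set₁ where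
      field
        Invariant         : ℕ → State → V G → Set
        invariant-start   : ∀ v → Invariant 0 (start v) v
        invariant-update  : ∀ {t s u v} → Invariant t s u → Step u v →
                            Invariant (suc t) (update s u v) v
        placement-legal   : ∀ v → LegalMove placement (formation (start v) v)
        formation-legal   : ∀ {t s u v} → Invariant t s u → Step u v →
                            LegalMove (formation s u) (formation (update s u v) v)
        deadline          : ℕ
        surrounds         : ∀ {t s v} → deadline ≤ t → Invariant t s v →
                            Surrounded (formation s v) v

    certified-strategy-wins : Certificate → Winning strategy
    certified-strategy-wins certificate p p-legal = moves-legal , deadline , surrounded
      where
      open Certificate certificate

      invariant : ∀ t → Invariant t (run p t) (p t)
      invariant zero    = invariant-start (p 0)
      invariant (suc t) = invariant-update (invariant t) (p-legal t)

      moves-legal : ∀ t → LegalMove (conf strategy p t) (conf strategy p (suc t))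
      moves-legal zero =
        subst (LegalMove placement) (sym (conf-strategy p 0)) (placement-legal (p 0))
      moves-legal (suc t) =
        subst₂ LegalMove (sym (conf-strategy p t)) (sym (conf-strategy p (suc t)))
               (formation-legal (invariant t) (p-legal t))

      surrounded : ∀ t → deadline ≤ t → Surrounded (conf strategy p (suc t)) (p t)
      surrounded t deadline≤t =
        subst (λ c → Surrounded c (p t)) (sym (conf-strategy p t))
              (surrounds deadline≤t (invariant t))

module ThreeGuardsOnP₃□P₂ where
  open Game (PathGrid 3 2)
  open GameProperties (PathGrid 3 2)

  formation : Fin 3 × Fin 2 → Conf 3
  formation (0F , 0F) = (0F , 0F) ∷ (0F , 1F) ∷ (1F , 0F) ∷ []
  formation (0F , 1F) = (0F , 0F) ∷ (1F , 1F) ∷ (0F , 0F) ∷ []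
  formation (1F , 0F) = (0F , 0F) ∷ (1F , 1F) ∷ (2F , 0F) ∷ []
  formation (1F , 1F) = (0F , 1F) ∷ (2F , 1F) ∷ (1F , 0F) ∷ []
  formation (2F , 0F) = (0F , 0F) ∷ (2F , 1F) ∷ (1F , 0F) ∷ []
  formation (2F , 1F) = (0F , 0F) ∷ (1F , 1F) ∷ (2F , 0F) ∷ []

  placement : Conf 3
  placement = (0F , 0F) ∷ (1F , 1F) ∷ (1F , 0F) ∷ []

  formation-surrounds : ∀ v → Surrounded (formation v) v
  formation-surrounds = from-yes (all-vertices? λ v → surrounded? (formation v) v)

  formation-legal : ∀ u v → E (PathGrid 3 2) u v → LegalMove (formation u) (formation v)
  formation-legal = from-yes (all-vertices? λ u → all-vertices? λ v →
    adjacent? u v →-dec legal? (formation u) (formation v))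

  placement-legal : ∀ v → LegalMove placement (formation v)
  placement-legal = from-yes (all-vertices? λ v → legal? placement (formation v))

  open Controlled placement (λ _ → tt) (λ _ _ _ → tt) (λ _ → formation)

  three-guards-win : BodyguardsWin 3
  three-guards-win = strategy , certified-strategy-wins record
    { Invariant        = λ _ _ _ → ⊤
    ; invariant-start  = λ _ → tt
    ; invariant-update = λ _ _ → tt
    ; placement-legal  = placement-legal
    ; formation-legal  = λ { _ (inj₁ refl) _ → inj₁ refl
                          ; _ (inj₂ uv)     → formation-legal _ _ uv }
    ; deadline         = 0
    ; surrounds        = λ _ _ → formation-surrounds _
    }

fewer-than-three-lose : ∀ k → k < 3 → ¬ Game.BodyguardsWin (PathGrid 3 2) k
fewer-than-three-lose = fewer-guards-than-neighbours-lose (1F , 0F) neighbours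
  (from-yes (all? λ j → adjacent? (1F , 0F) (neighbours j))) (from-yes (injective? neighbours))
  where
  open GameProperties (PathGrid 3 2)
  neighbours : Fin 3 → Fin 3 × Fin 2
  neighbours = (0F , 0F) ∷ (2F , 0F) ∷ (1F , 1F) ∷ []

B[P₃□P₂]≡3 : BodyguardNumberIs (PathGrid 3 2) 3
B[P₃□P₂]≡3 = ThreeGuardsOnP₃□P₂.three-guards-win , fewer-than-three-lose

-- Steps in the lattice of (row , column) pairs. The four-guard formations live in this
-- lattice and are clamped onto the grid.
data _↝_ : ℕ × ℕ → ℕ × ℕ → Set where
  stay  : ∀ {a b} → (a , b) ↝ (a , b)
  right : ∀ {a b} → (a , b) ↝ (a , suc b)
  left  : ∀ {a b} → (a , suc b) ↝ (a , b)
  down  : ∀ {a b} → (a , b) ↝ (suc a , b)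
  up    : ∀ {a b} → (suc a , b) ↝ (a , b)

module Clamped (a b : ℕ) where
  open GameProperties (PathGrid (suc a) (suc b)) using (Step)

  vertex : ℕ × ℕ → Fin (suc a) × Fin (suc b)
  vertex (x , y) = clamp a x , clamp b y

  vertex-toℕ : ∀ r c → vertex (toℕ r , toℕ c) ≡ (r , c)
  vertex-toℕ r c = cong₂ _,_ (clamp-toℕ r) (clamp-toℕ c)

  vertex-↝ : ∀ {P Q} → P ↝ Q → Step (vertex P) (vertex Q)
  vertex-↝ stay = inj₁ refl
  vertex-↝ {x , y} right with clamp-suc b y
  ... | inj₁ same = inj₁ (cong (clamp a x ,_) same)
  ... | inj₂ next = inj₂ (inj₂ (refl , inj₁ next))
  vertex-↝ {x , suc y} left with clamp-suc b y
  ... | inj₁ same = inj₁ (cong (clamp a x ,_) (sym same))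
  ... | inj₂ next = inj₂ (inj₂ (refl , inj₂ next))
  vertex-↝ {x , y} down with clamp-suc a x
  ... | inj₁ same = inj₁ (cong (_, clamp b y) same)
  ... | inj₂ next = inj₂ (inj₁ (inj₁ next , refl))
  vertex-↝ {suc x , y} up with clamp-suc a x
  ... | inj₁ same = inj₁ (cong (_, clamp b y) (sym same))
  ... | inj₂ next = inj₂ (inj₁ (inj₂ next , refl))

↝-pred : ∀ {a b} → (a , b) ↝ (a , pred b)
↝-pred {b = zero}  = stay
↝-pred {b = suc b} = left

pred-↝ : ∀ {a b} → (a , pred b) ↝ (a , b)
pred-↝ {b = zero}  = stay
pred-↝ {b = suc b} = right

PathAdj-↝ : ∀ {n c} {i j : Fin n} → PathAdj n i j → (toℕ i , c) ↝ (toℕ j , c)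
PathAdj-↝ (inj₁ j≡1+i) rewrite j≡1+i = down
PathAdj-↝ (inj₂ i≡1+j) rewrite i≡1+j = up

middle-↝ : ∀ {c} (r : Fin 3) → (1 , c) ↝ (toℕ r , c)
middle-↝ 0F = up
middle-↝ 1F = stay
middle-↝ 2F = down

sucIf : Bool → ℕ → ℕ
sucIf true  = suc
sucIf false b = b

↝-sucIf : ∀ {a b} c → (a , b) ↝ (a , sucIf c b)
↝-sucIf true  = right
↝-sucIf false = stay

suc-↝-sucIf : ∀ {a b} c → (a , suc b) ↝ (a , sucIf c b)
suc-↝-sucIf true  = stay
suc-↝-sucIf false = left

sucIf-right : ∀ {a b} c → (a , sucIf c b) ↝ (a , sucIf c (suc b))
sucIf-right true  = right
sucIf-right false = right

sucIf-left : ∀ {a b} c → (a , sucIf c (suc b)) ↝ (a , sucIf c b)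
sucIf-left true  = left
sucIf-left false = left

-- President moves on the half-infinite strip P₃ □ P_∞.
data _⇒_ : Fin 3 × ℕ → Fin 3 × ℕ → Set where
  stay     : ∀ {r b} → (r , b) ⇒ (r , b)
  right    : ∀ {r b} → (r , b) ⇒ (r , suc b)
  left     : ∀ {r b} → (r , suc b) ⇒ (r , b)
  vertical : ∀ {r r′ b} → PathAdj 3 r r′ → (r , b) ⇒ (r′ , b)

⇒-column : ∀ {x u v} → x < proj₂ u → u ⇒ v → x ≤ proj₂ v
⇒-column x<b stay         = <⇒≤ x<b
⇒-column x<b right        = ≤-trans (<⇒≤ x<b) (n≤1+n _)
⇒-column x<b left         = ≤-pred x<b
⇒-column x<b (vertical _) = <⇒≤ x<b

data Role : Set where
  guardOf : Fin 3 → Role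
  back    : Role

role : Fin 4 → Role
role 0F = guardOf 0F
role 1F = guardOf 1F
role 2F = guardOf 2F
role 3F = back

index : Role → Fin 4
index (guardOf r) = inject₁ r
index back        = 3F

role-index : ∀ ρ → role (index ρ) ≡ ρ
role-index (guardOf 0F) = refl
role-index (guardOf 1F) = refl
role-index (guardOf 2F) = refl
role-index back         = refl

-- For a president that steps onto the wall: the guard of its row drops behind it and
-- the fourth guard, from the middle row, takes its place.
backSwap : Fin 3 → Permutation′ 4
backSwap r = transpose (index (guardOf r)) (index back)

wall : ℕ → Role → ℕ × ℕ
wall x (guardOf a) = toℕ a , x
wall x back        = 1 , x

-- In column 0, pred 0 = 0 puts the back guard on the president's own vertex; there is
-- then no vertex behind the president to guard.
chase : Fin 3 × ℕ → Role → ℕ × ℕ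
chase (r , b) (guardOf a) = toℕ a , b
chase (r , b) back        = toℕ r , pred b

surround : Fin 3 × ℕ → Role → ℕ × ℕ
surround (r , b) (guardOf a) = toℕ a , sucIf (does (a ≟ᶠ r)) b
surround (r , b) back        = toℕ r , pred b

surround-own-row : ∀ r b → surround (r , b) (guardOf r) ≡ (toℕ r , suc b)
surround-own-row r b rewrite dec-true (r ≟ᶠ r) refl = refl

surround-other-row : ∀ {a r} b → a ≢ r → surround (r , b) (guardOf a) ≡ (toℕ a , b)
surround-other-row {a} {r} b a≢r rewrite dec-false (a ≟ᶠ r) a≢r = refl

wall-advance-↝ : ∀ x ρ → wall x ρ ↝ wall (suc x) ρ
wall-advance-↝ x (guardOf a) = right
wall-advance-↝ x back        = right

wall-to-chase-↝ : ∀ r x ρ → wall x ρ ↝ chase (r , suc x) ρ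
wall-to-chase-↝ r x (guardOf a) = right
wall-to-chase-↝ r x back        = middle-↝ r

wall-to-swapped-chase-↝ : ∀ r x i → wall x (role i) ↝ chase (r , x) (role (backSwap r ⟨$⟩ʳ i))
wall-to-swapped-chase-↝ 0F x 0F = ↝-pred
wall-to-swapped-chase-↝ 0F x 1F = stay
wall-to-swapped-chase-↝ 0F x 2F = stay
wall-to-swapped-chase-↝ 0F x 3F = up
wall-to-swapped-chase-↝ 1F x 0F = stay
wall-to-swapped-chase-↝ 1F x 1F = ↝-pred
wall-to-swapped-chase-↝ 1F x 2F = stay
wall-to-swapped-chase-↝ 1F x 3F = stay
wall-to-swapped-chase-↝ 2F x 0F = stay
wall-to-swapped-chase-↝ 2F x 1F = stay
wall-to-swapped-chase-↝ 2F x 2F = ↝-pred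
wall-to-swapped-chase-↝ 2F x 3F = down

chase-right-↝ : ∀ r b ρ → chase (r , b) ρ ↝ chase (r , suc b) ρ
chase-right-↝ r b (guardOf a) = right
chase-right-↝ r b back        = pred-↝

chase-stay-↝ : ∀ r b ρ → chase (r , b) ρ ↝ surround (r , b) ρ
chase-stay-↝ r b (guardOf a) = ↝-sucIf _
chase-stay-↝ r b back        = stay

chase-left-↝ : ∀ r b ρ → chase (r , suc b) ρ ↝ surround (r , b) ρ
chase-left-↝ r b (guardOf a) = suc-↝-sucIf _
chase-left-↝ r b back        = ↝-pred

chase-vertical-↝ : ∀ {r r′} → PathAdj 3 r r′ → ∀ b ρ → chase (r , b) ρ ↝ surround (r′ , b) ρ
chase-vertical-↝ adj b (guardOf a) = ↝-sucIf _
chase-vertical-↝ adj b back        = PathAdj-↝ adj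

surround-↝ : ∀ {u v} → u ⇒ v → ∀ ρ → surround u ρ ↝ surround v ρ
surround-↝ stay    ρ           = stay
surround-↝ right   (guardOf a) = sucIf-right _
surround-↝ right   back        = pred-↝
surround-↝ left    (guardOf a) = sucIf-left _
surround-↝ left    back        = ↝-pred
surround-↝ (vertical {r} {r′} adj) (guardOf a) with a ≟ᶠ r | a ≟ᶠ r′
... | yes refl | yes refl = contradiction adj PathAdj-irrefl
... | yes _    | no _     = left
... | no _     | yes _    = right
... | no _     | no _     = stay
surround-↝ (vertical adj) back = PathAdj-↝ adj

data Mode : Set where
  walling     : ℕ → Mode
  chasing     : Permutation′ 4 → Mode
  surrounding : Permutation′ 4 → Mode

layout : Mode → Fin 3 × ℕ → Fin 4 → ℕ × ℕ
layout (walling x)     _ i = wall x (role i)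
layout (chasing π)     u i = chase u (role (π ⟨$⟩ʳ i))
layout (surrounding π) u i = surround u (role (π ⟨$⟩ʳ i))

-- Under Progress, b ≤ x only happens for b ≡ x: the president stands on the wall.
next : Mode → Fin 3 × ℕ → Fin 3 × ℕ → Mode
next (walling x) _ (r , b) with b ≤? x | b ≟ suc x
... | yes _ | _     = chasing (backSwap r)
... | no _  | yes _ = chasing idₚ
... | no _  | no _  = walling (suc x)
next (chasing π) (_ , b₀) (_ , b) with b ≟ suc b₀
... | yes _ = chasing π
... | no _  = surrounding π
next (surrounding π) _ _ = surrounding π

-- The wall stays ahead of the clock and the chase keeps the president's column there,
-- so with m + 1 columns neither phase lasts beyond time m + 1.
Progress : Mode → ℕ → ℕ → Set
Progress (walling x)     t b = t < x × x < b
Progress (chasing _)     t b = t ≤ b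
Progress (surrounding _) _ _ = ⊤

walling-↝ : ∀ x u v → x ≤ proj₂ v →
            ∀ i → layout (walling x) u i ↝ layout (next (walling x) u v) v i
walling-↝ x u (r , b) x≤b i with b ≤? x | b ≟ suc x
... | yes b≤x | _ with refl ← ≤-antisym b≤x x≤b = wall-to-swapped-chase-↝ r x i
... | no _    | yes refl = wall-to-chase-↝ r x (role i)
... | no _    | no _     = wall-advance-↝ x (role i)

walling-progress : ∀ x u v {s} → s ≤ x → x ≤ proj₂ v →
                   Progress (next (walling x) u v) s (proj₂ v)
walling-progress x u (r , b) s≤x x≤b with b ≤? x | b ≟ suc x
... | yes _  | _        = ≤-trans s≤x x≤b
... | no _   | yes refl = ≤-trans s≤x x≤b
... | no b≰x | no b≢1+x = s≤s s≤x , ≤∧≢⇒< (≰⇒> b≰x) (λ 1+x≡b → b≢1+x (sym 1+x≡b))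

chasing-↝ : ∀ π {u v} → u ⇒ v →
            ∀ i → layout (chasing π) u i ↝ layout (next (chasing π) u v) v i
chasing-↝ π {r , b} right i with suc b ≟ suc b
... | yes _   = chase-right-↝ r b _
... | no b≢b  = contradiction refl b≢b
chasing-↝ π {r , b} stay i with b ≟ suc b
... | yes b≡1+b = contradiction (n<1+n b) (<-irrefl b≡1+b)
... | no _      = chase-stay-↝ r b _
chasing-↝ π {r , suc b} left i with b ≟ suc (suc b)
... | yes b≡2+b = contradiction (m<n⇒m<1+n (n<1+n b)) (<-irrefl b≡2+b)
... | no _      = chase-left-↝ r b _
chasing-↝ π {r , b} (vertical adj) i with b ≟ suc b
... | yes b≡1+b = contradiction (n<1+n b) (<-irrefl b≡1+b)
... | no _      = chase-vertical-↝ adj b _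

layout-↝ : ∀ md {t u v} → Progress md t (proj₂ u) → u ⇒ v →
           ∀ i → layout md u i ↝ layout (next md u v) v i
layout-↝ (walling x)     {u = u} {v} (_ , x<b) mv = walling-↝ x u v (⇒-column x<b mv)
layout-↝ (chasing π)     _ mv = chasing-↝ π mv
layout-↝ (surrounding π) _ mv i = surround-↝ mv _

progress-next : ∀ md {t u v} → Progress md t (proj₂ u) → u ⇒ v →
                Progress (next md u v) (suc t) (proj₂ v)
progress-next (walling x) {u = u} {v} (t<x , x<b) mv =
  walling-progress x u v t<x (⇒-column x<b mv)
progress-next (chasing π) {u = _ , b₀} {_ , b} t≤b₀ mv with b ≟ suc b₀
... | yes refl = s≤s t≤b₀
... | no _     = tt
progress-next (surrounding π) _ _ = tt

module FourGuardsOnThreeRows (m : ℕ) where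
  Grid : GraphOn
  Grid = PathGrid 3 (suc m)
  open Game Grid
  open GameProperties Grid
  open Clamped 2 m

  coords : Fin 3 × Fin (suc m) → Fin 3 × ℕ
  coords (r , c) = r , toℕ c

  coords-⇒ : ∀ {u v} → Step u v → coords u ⇒ coords v
  coords-⇒ (inj₁ refl) = stay
  coords-⇒ (inj₂ (inj₁ (adj , refl))) = vertical adj
  coords-⇒ (inj₂ (inj₂ (refl , inj₁ c′≡1+c))) rewrite c′≡1+c = right
  coords-⇒ (inj₂ (inj₂ (refl , inj₂ c≡1+c′))) rewrite c≡1+c′ = left

  surround-covers : ∀ r c w → E Grid (r , c) w → ∃[ ρ ] vertex (surround (r , toℕ c) ρ) ≡ w
  surround-covers r c (r′ , _) (inj₁ (adj , refl)) with r′ ≟ᶠ r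
  ... | yes refl = contradiction adj PathAdj-irrefl
  ... | no r′≢r  =
    guardOf r′ , trans (cong vertex (surround-other-row (toℕ c) r′≢r)) (vertex-toℕ r′ c)
  surround-covers r c (_ , c′) (inj₂ (refl , inj₁ c′≡1+c)) =
    guardOf r , trans (cong vertex (surround-own-row r (toℕ c)))
                      (subst (λ y → vertex (toℕ r , y) ≡ (r , c′)) c′≡1+c (vertex-toℕ r c′))
  surround-covers r c (_ , c′) (inj₂ (refl , inj₂ c≡1+c′)) rewrite c≡1+c′ =
    back , vertex-toℕ r c′

  formation : Mode → Fin 3 × Fin (suc m) → Conf 4
  formation md v i = vertex (layout md (coords v) i)

  placement : Conf 4
  placement i = vertex (wall 0 (role i))

  open Controlled placement (λ v → next (walling 0) (coords v) (coords v))
                  (λ md u v → next md (coords u) (coords v)) formation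

  surrounds : ∀ {t md v} → suc m ≤ t → Progress md t (toℕ (proj₂ v)) →
              Surrounded (formation md v) v
  surrounds {md = walling x} {_ , c} m<t (t<x , x<b) =
    contradiction (<-trans t<x (<-trans x<b (≤-<-trans (toℕ≤pred[n] c) m<t))) (<-irrefl refl)
  surrounds {md = chasing π} {_ , c} m<t t≤b =
    contradiction (≤-<-trans t≤b (≤-<-trans (toℕ≤pred[n] c) m<t)) (<-irrefl refl)
  surrounds {md = surrounding π} {r , c} _ _ w adj with ρ , covers ← surround-covers r c w adj =
    π ⟨$⟩ˡ index ρ , trans (cong (post ∘ role) (inverseʳ π)) (trans (cong post (role-index ρ)) covers)
    where
    post : Role → Fin 3 × Fin (suc m)
    post ρ′ = vertex (surround (r , toℕ c) ρ′)

  four-guards-win : BodyguardsWin 4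
  four-guards-win = strategy , certified-strategy-wins record
    { Invariant        = λ t md v → Progress md t (toℕ (proj₂ v))
    ; invariant-start  = λ v → walling-progress 0 (coords v) (coords v) z≤n z≤n
    ; invariant-update = λ {_} {md} inv uv → progress-next md inv (coords-⇒ uv)
    ; placement-legal  = λ v i → vertex-↝ (walling-↝ 0 (coords v) (coords v) z≤n i)
    ; formation-legal  = λ {_} {md} inv uv i → vertex-↝ (layout-↝ md inv (coords-⇒ uv) i)
    ; deadline         = suc m
    ; surrounds        = surrounds
    }

fewer-than-four-lose : ∀ m k → k < 4 → ¬ Game.BodyguardsWin (PathGrid 3 (3 + m)) k
fewer-than-four-lose m = fewer-guards-than-neighbours-lose (1F , 1F) neighbours
  (from-yes (all? λ j → adjacent? (1F , 1F) (neighbours j))) (from-yes (injective? neighbours))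
  where
  open GameProperties (PathGrid 3 (3 + m))
  neighbours : Fin 4 → Fin 3 × Fin (3 + m)
  neighbours = (0F , 1F) ∷ (2F , 1F) ∷ (1F , 0F) ∷ (1F , 2F) ∷ []

B[P₃□P₃₊ₘ]≡4 : ∀ m → BodyguardNumberIs (PathGrid 3 (3 + m)) 4
B[P₃□P₃₊ₘ]≡4 m = FourGuardsOnThreeRows.four-guards-win (2 + m) , fewer-than-four-lose m

lemma4p3 : (n : ℕ) → 2 ≤ n →
    (n ≡ 2 → BodyguardNumberIs (PathGrid 3 n) 3) ×
    (3 ≤ n → BodyguardNumberIs (PathGrid 3 n) 4)
lemma4p3 n _ = (λ { refl → B[P₃□P₂]≡3 }) , (λ { (s≤s (s≤s (s≤s _))) → B[P₃□P₃₊ₘ]≡4 _ })
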